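{- Let $n\ge1$, $1\le k\le n$, $A=\{a_1,\dots,a_n\}$ and $S$ the power set of $A$. For $u\in S$ let $f(u)=(s_1,\dots,s_n)$ with $s_j\equiv\#\{i: a_i\in u,\ i\mid j\}\pmod 2$. Let $\sigma(\{1\})$ denote the set of squarefree positive integers and $k\cdot\sigma(\{1\})=\{ks: s\in\sigma(\{1\})\}$. Then for $u\in S$: $u=\{a_i : 1\le i\le n,\ i\in k\cdot\sigma(\{1\})\}$ if and only if $f(u)$ is the string with $s_k=1$ and $s_j=0$ for all $j\neq k$.
   Context: Locker problem: $n$ lockers numbered $1,\dots,n$, initially all closed; each student $a_i\in u$ changes the state of every locker whose number is a multiple of $i$; $f(u)$ is the final state with $1$ = open, $0$ = closed. A positive integer is squarefree if no prime square divides it ($1$ is squarefree). -}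

module Defs where

open import Data.Nat using (ℕ; zero; suc; _*_; _≥_)
open import Data.Nat.Divisibility using (_∣_)
open import Data.Nat.Primality using (Prime)
open import Data.Bool using (Bool; true; false; _xor_; _∧_; if_then_else_)
open import Data.Fin using (Fin; toℕ)
open import Data.Product using (Σ; _×_)
open import Relation.Nullary using (¬_)
open import Relation.Nullary.Decidable using (⌊_⌋)
open import Data.Nat.Divisibility using (_∣?_)

-- Lockers and students are indexed by Fin n; index i : Fin n stands for
-- the number (toℕ i + 1) ∈ {1,…,n}.
num : {n : ℕ} → Fin n → ℕ
num i = suc (toℕ i)

-- A subset u of A = {a_1,…,a_n}: u i = true iff a_(num i) ∈ u.
Subset : ℕ → Set
Subset n = Fin n → Bool

BitString : ℕ → Set
BitString n = Fin n → Bool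

parity : (n : ℕ) → (Fin n → Bool) → Bool
parity zero    b = false
parity (suc n) b = b Fin.zero xor parity n (λ i → b (Fin.suc i))

f : {n : ℕ} → Subset n → BitString n
f {n} u j = parity n (λ i → u i ∧ ⌊ num i ∣? num j ⌋)

SquareFree : ℕ → Set
SquareFree m = m ≥ 1 × ((p : ℕ) → Prime p → ¬ (p * p ∣ m))

InKSigma1 : ℕ → ℕ → Set
InKSigma1 k m = Σ ℕ (λ s → SquareFree s × m ≡ k * s)
  where open import Relation.Binary.PropositionalEquality using (_≡_)

module Submission where

-- Write D P m for the parity of #{d ∣ m : P d}; then f u is D u read off at 1, …, n.
-- The divisors of m in k·σ({1}) are the k s with s a squarefree divisor of m / k (there are
-- none when k ∤ m), and every t > 1 has evenly many squarefree divisors, because s ↦ p s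
-- pairs those prime to a prime factor p of t with those divisible by p. Hence D χ m = [m = k]
-- for the indicator χ of k·σ({1}). As D P m is P m plus a function of P on [1, m), P ↦ D P
-- is injective on [1, n], so the subset χ is the only one sent to the string e_k.

open import Defs
open import Algebra.Bundles using (CommutativeRing)
open import Data.Bool using (Bool; true; false; _∧_; _xor_; not)
open import Data.Bool.Properties
  using (∧-identityʳ; ∧-zeroʳ; xor-assoc; ∧-distribˡ-xor; xor-inverseʳ; xor-identityʳ; xor-same; xor-∧-commutativeRing)
open import Data.Fin using (Fin; fromℕ<)
open import Data.Fin.Properties using (toℕ<n; toℕ-fromℕ<)
open import Data.Nat using (ℕ; zero; suc; _*_; _+_; _≤_; _<_; z≤n; s≤s; z<s; NonZero; _≟_)
open import Data.Nat.Coprimality using (Coprime; coprime-divisor) renaming (sym to Coprime-sym)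
open import Data.Nat.Divisibility
  using (_∣_; _∣?_; divides; ∣-refl; ∣1⇒≡1; ∣-trans; ∣⇒≤; >⇒∤; m∣m*n; n∣m*n; *-monoʳ-∣; *-cancelˡ-∣)
open import Data.Nat.Primality using (Prime; prime?; ¬prime[1]; prime⇒nonZero; prime⇒irreducible; euclidsLemma)
open import Data.Nat.Primality.Factorisation using (factorise)
open import Data.Nat.Properties
  using (≤-refl; ≤-trans; <⇒≱; m≤n⇒m≤1+n; m≤n⇒m<n∨m≡n; m≤m+n; m≤m*n; m≤n*m; +-comm; *-comm; *-assoc;
         *-suc; *-zeroʳ; *-identityˡ; m*n≡1⇒n≡1; *-monoʳ-≤; *-cancelˡ-≤; *-cancelˡ-<; *-cancelʳ-<;
         *-cancelˡ-≡; *-cancelʳ-≡; allUpTo?)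
open import Data.List using ([]; _∷_)
open import Data.List.Relation.Unary.All using (_∷_)
open import Data.Product using (Σ; ∃-syntax; _×_; _,_; proj₁; proj₂)
open import Data.Sum using (inj₁; inj₂; reduce)
open import Function.Base using (_∘_; _⟨_⟩_)
open import Function.Properties.Equivalence using () renaming (trans to ⇔-trans; sym to ⇔-sym)
open import Function.Bundles using (_⇔_; mk⇔; Equivalence)
open import Relation.Nullary using (¬_; Dec; yes; no; does; contradiction)
open import Relation.Nullary.Decidable
  using (_×-dec_; ¬?; _→-dec_; map′; dec-true; dec-false; does-≡; isYes≗does)
open import Relation.Unary using (Decidable)
open import Relation.Binary.PropositionalEquality
  using (_≡_; _≢_; refl; sym; trans; cong; cong₂; subst; module ≡-Reasoning)

open CommutativeRing xor-∧-commutativeRing using ()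
  renaming (+-commutativeSemigroup to xor-commutativeSemigroup; +-group to xor-group)
open import Algebra.Properties.CommutativeSemigroup xor-commutativeSemigroup using (interchange)
open import Algebra.Properties.Group xor-group using (∙-cancelˡ)

does-⇔ : ∀ {a b} {A : Set a} {B : Set b} → A ⇔ B → (a? : Dec A) (b? : Dec B) → does a? ≡ does b?
does-⇔ A⇔B a? b? = does-≡ (map′ (Equivalence.to A⇔B) (Equivalence.from A⇔B) a?) b?

≡true⇔⇔≡does : ∀ {a} {A : Set a} {b : Bool} (a? : Dec A) → (b ≡ true ⇔ A) ⇔ (b ≡ does a?)
≡true⇔⇔≡does {b = true}  (yes a)  = mk⇔ (λ _ → refl) (λ _ → mk⇔ (λ _ → a) (λ _ → refl))
≡true⇔⇔≡does {b = true}  (no ¬a)  = mk⇔ (λ t⇔A → contradiction (Equivalence.to t⇔A refl) ¬a) (λ ())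
≡true⇔⇔≡does {b = false} (yes a)  = mk⇔ (λ f⇔A → contradiction (Equivalence.from f⇔A a) λ ()) (λ ())
≡true⇔⇔≡does {b = false} (no ¬a)  = mk⇔ (λ _ → refl) (λ _ → mk⇔ (λ ()) (λ a → contradiction a ¬a))

cases⇔≡does : ∀ {a} {A : Set a} {b : Bool} (a? : Dec A) →
  ((A → b ≡ true) × (¬ A → b ≡ false)) ⇔ (b ≡ does a?)
cases⇔≡does (yes a) =
  mk⇔ (λ (if-A , _) → if-A a) (λ b≡true → (λ _ → b≡true) , λ ¬a → contradiction a ¬a)
cases⇔≡does (no ¬a) =
  mk⇔ (λ (_ , if-¬A) → if-¬A ¬a) (λ b≡false → (λ a → contradiction a ¬a) , λ _ → b≡false)

∀-⇔ : ∀ {a b c} {I : Set a} {A : I → Set b} {B : I → Set c} →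
  (∀ i → A i ⇔ B i) → (∀ i → A i) ⇔ (∀ i → B i)
∀-⇔ A⇔B = mk⇔ (λ as i → Equivalence.to (A⇔B i) (as i)) (λ bs i → Equivalence.from (A⇔B i) (bs i))

parityUpTo : (ℕ → Bool) → ℕ → Bool
parityUpTo P zero    = false
parityUpTo P (suc N) = parityUpTo P N xor P (suc N)

parityUpTo-cong : ∀ {P Q} N → (∀ d → 0 < d → d ≤ N → P d ≡ Q d) → parityUpTo P N ≡ parityUpTo Q N
parityUpTo-cong zero    _   = refl
parityUpTo-cong (suc N) P≗Q =
  cong₂ _xor_ (parityUpTo-cong N (λ d 0<d d≤N → P≗Q d 0<d (m≤n⇒m≤1+n d≤N))) (P≗Q (suc N) z<s ≤-refl)

parityUpTo-xor : ∀ P Q N → parityUpTo (λ d → P d xor Q d) N ≡ parityUpTo P N xor parityUpTo Q N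
parityUpTo-xor P Q zero    = refl
parityUpTo-xor P Q (suc N) =
  trans (cong (_xor (P (suc N) xor Q (suc N))) (parityUpTo-xor P Q N))
        (interchange (parityUpTo P N) (parityUpTo Q N) (P (suc N)) (Q (suc N)))

parityUpTo-split : ∀ P (e : ℕ → Bool) N →
  parityUpTo P N ≡ parityUpTo (λ d → P d ∧ e d) N xor parityUpTo (λ d → P d ∧ not (e d)) N
parityUpTo-split P e N =
  trans (parityUpTo-cong N (λ d _ _ → split (P d) (e d)))
        (parityUpTo-xor (λ d → P d ∧ e d) (λ d → P d ∧ not (e d)) N)
  where
  split : ∀ p b → p ≡ (p ∧ b) xor (p ∧ not b)
  split p b = trans (sym (∧-identityʳ p)) (trans (cong (p ∧_) (sym (xor-inverseʳ b))) (∧-distribˡ-xor p b (not b)))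

parityUpTo-tail : ∀ P {M N} → M ≤ N → (∀ d → M < d → d ≤ N → P d ≡ false) → parityUpTo P N ≡ parityUpTo P M
parityUpTo-tail P {N = zero}  z≤n _ = refl
parityUpTo-tail P {M} {suc N} M≤1+N vanish with m≤n⇒m<n∨m≡n M≤1+N
... | inj₂ refl       = refl
... | inj₁ (s≤s M≤N) = begin
  parityUpTo P N xor P (suc N)  ≡⟨ cong₂ _xor_ (parityUpTo-tail P M≤N vanish′) (vanish (suc N) (s≤s M≤N) ≤-refl) ⟩
  parityUpTo P M xor false      ≡⟨ xor-identityʳ _ ⟩
  parityUpTo P M                ∎
  where
  open ≡-Reasoning
  vanish′ : ∀ d → M < d → d ≤ N → P d ≡ false
  vanish′ d M<d d≤N = vanish d M<d (m≤n⇒m≤1+n d≤N)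

∣∧<⇒*suc≤ : ∀ k t {d} → k ∣ d → k * t < d → k * suc t ≤ d
∣∧<⇒*suc≤ k t {d} (divides q refl) kt<qk =
  subst (k * suc t ≤_) (*-comm k q) (*-monoʳ-≤ k (*-cancelˡ-< k t q (subst (k * t <_) (*-comm q k) kt<qk)))

parityUpTo-multiples : ∀ P k .{{_ : NonZero k}} → (∀ d → ¬ k ∣ d → P d ≡ false) →
  ∀ t → parityUpTo P (k * t) ≡ parityUpTo (λ s → P (k * s)) t
parityUpTo-multiples P k _     zero    = cong (parityUpTo P) (*-zeroʳ k)
parityUpTo-multiples P k@(suc k′) P∣ (suc t) = begin
  parityUpTo P (k * suc t)                         ≡⟨ cong (parityUpTo P) k[1+t]≡ ⟩
  parityUpTo P (k * t + k′) xor P (suc (k * t + k′)) ≡⟨ cong₂ _xor_ (parityUpTo-tail P (m≤m+n _ k′) gap) (cong P (sym k[1+t]≡)) ⟩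
  parityUpTo P (k * t) xor P (k * suc t)           ≡⟨ cong (_xor P (k * suc t)) (parityUpTo-multiples P k P∣ t) ⟩
  parityUpTo (λ s → P (k * s)) (suc t)             ∎
  where
  open ≡-Reasoning
  k[1+t]≡ : k * suc t ≡ suc (k * t + k′)
  k[1+t]≡ = trans (*-suc k t) (cong suc (+-comm k′ (k * t)))
  gap : ∀ d → k * t < d → d ≤ k * t + k′ → P d ≡ false
  gap d kt<d d≤ = P∣ d λ k∣d → <⇒≱ (s≤s d≤) (subst (_≤ d) k[1+t]≡ (∣∧<⇒*suc≤ k t k∣d kt<d))

parityUpTo-shift : ∀ P N → parityUpTo P (suc N) ≡ P 1 xor parityUpTo (P ∘ suc) N
parityUpTo-shift P zero    = sym (xor-identityʳ (P 1))
parityUpTo-shift P (suc N) =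
  trans (cong (_xor P (suc (suc N))) (parityUpTo-shift P N)) (xor-assoc (P 1) _ _)

parity-cong : ∀ n {b c : Fin n → Bool} → (∀ i → b i ≡ c i) → parity n b ≡ parity n c
parity-cong zero    _   = refl
parity-cong (suc n) b≗c = cong₂ _xor_ (b≗c Fin.zero) (parity-cong n (b≗c ∘ Fin.suc))

parity≡parityUpTo : ∀ n P → parity n (P ∘ num) ≡ parityUpTo P n
parity≡parityUpTo zero    P = refl
parity≡parityUpTo (suc n) P = trans (cong (P 1 xor_) (parity≡parityUpTo n (P ∘ suc))) (sym (parityUpTo-shift P n))

divisorParity : (ℕ → Bool) → ℕ → Bool
divisorParity P m = parityUpTo (λ d → P d ∧ does (d ∣? m)) m

divisorParity-upTo : ∀ P {m N} → 0 < m → m ≤ N →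
  parityUpTo (λ d → P d ∧ does (d ∣? m)) N ≡ divisorParity P m
divisorParity-upTo P {m@(suc _)} _ m≤N = parityUpTo-tail _ m≤N λ d m<d _ →
  trans (cong (P d ∧_) (dec-false (d ∣? m) (>⇒∤ m<d))) (∧-zeroʳ (P d))

divisorParity-cong : ∀ {P Q} m → (∀ d → 0 < d → d ≤ m → P d ≡ Q d) → divisorParity P m ≡ divisorParity Q m
divisorParity-cong {P} {Q} m P≗Q = parityUpTo-cong m λ d 0<d d≤m → cong (_∧ does (d ∣? m)) (P≗Q d 0<d d≤m)

divisorParity-suc : ∀ P N →
  divisorParity P (suc N) ≡ parityUpTo (λ d → P d ∧ does (d ∣? suc N)) N xor P (suc N)
divisorParity-suc P N = cong (parityUpTo (λ d → P d ∧ does (d ∣? suc N)) N xor_)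
  (trans (cong (P (suc N) ∧_) (dec-true (suc N ∣? suc N) ∣-refl)) (∧-identityʳ (P (suc N))))

-- Triangularity: divisorParity P (1 + N) is P (1 + N) plus a function of P on [1, N].
divisorParity-suc-cancel : ∀ {P Q} N → (∀ d → 0 < d → d ≤ N → P d ≡ Q d) →
  divisorParity P (suc N) ≡ divisorParity Q (suc N) → P (suc N) ≡ Q (suc N)
divisorParity-suc-cancel {P} {Q} N P≗Q P≈Q = ∙-cancelˡ (lower Q) (P (suc N)) (Q (suc N)) (begin
  lower Q xor P (suc N)    ≡⟨ cong (_xor P (suc N)) (sym lower-≡) ⟩
  lower P xor P (suc N)    ≡⟨ sym (divisorParity-suc P N) ⟩
  divisorParity P (suc N)  ≡⟨ P≈Q ⟩
  divisorParity Q (suc N)  ≡⟨ divisorParity-suc Q N ⟩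
  lower Q xor Q (suc N)    ∎)
  where
  open ≡-Reasoning
  lower : (ℕ → Bool) → Bool
  lower R = parityUpTo (λ d → R d ∧ does (d ∣? suc N)) N
  lower-≡ : lower P ≡ lower Q
  lower-≡ = parityUpTo-cong N λ d 0<d d≤N → cong (_∧ does (d ∣? suc N)) (P≗Q d 0<d d≤N)

divisorParity-injective : ∀ {P Q} N → (∀ m → 0 < m → m ≤ N → divisorParity P m ≡ divisorParity Q m) →
  ∀ d → 0 < d → d ≤ N → P d ≡ Q d
divisorParity-injective zero    _   (suc _) _ ()
divisorParity-injective (suc N) P≈Q d 0<d d≤1+N
  with m≤n⇒m<n∨m≡n d≤1+N | divisorParity-injective N (λ m 0<m m≤N → P≈Q m 0<m (m≤n⇒m≤1+n m≤N))
... | inj₁ (s≤s d≤N) | P≗Q = P≗Q d 0<d d≤N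
... | inj₂ refl      | P≗Q = divisorParity-suc-cancel N P≗Q (P≈Q (suc N) z<s ≤-refl)

squareFree? : Decidable SquareFree
squareFree? zero        = no λ ()
squareFree? n@(suc _)   =
  map′ (λ noSquare → z<s , λ p p-prime p²∣n → noSquare (bound p-prime p²∣n) p-prime p²∣n)
       (λ (_ , noSquare) {p} _ → noSquare p)
       (allUpTo? (λ p → prime? p →-dec ¬? (p * p ∣? n)) (suc n))
  where
  bound : ∀ {p} → Prime p → p * p ∣ n → p < suc n
  bound {p} p-prime p²∣n = s≤s (≤-trans (m≤m*n p p {{prime⇒nonZero p-prime}}) (∣⇒≤ p²∣n))

squareFree[1] : SquareFree 1
squareFree[1] = z<s , λ p p-prime p²∣1 → ¬prime[1] (subst Prime (m*n≡1⇒n≡1 p p (∣1⇒≡1 p²∣1)) p-prime)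

∃prime∣ : ∀ n → 1 < n → ∃[ p ] Prime p × p ∣ n
∃prime∣ (suc zero) (s≤s ())
∃prime∣ n@(suc (suc _)) _ with factorise n
... | record { factors = [] ; isFactorisation = () }
... | record { factors = p ∷ ps ; isFactorisation = n≡p*ps ; factorsPrime = p-prime ∷ _ } =
  p , p-prime , subst (p ∣_) (sym n≡p*ps) (m∣m*n _)

prime∣prime⇒≡ : ∀ {p q} → Prime p → Prime q → p ∣ q → p ≡ q
prime∣prime⇒≡ p-prime q-prime p∣q with prime⇒irreducible q-prime p∣q
... | inj₁ refl = contradiction p-prime ¬prime[1]
... | inj₂ p≡q  = p≡q

prime∤⇒coprime : ∀ {p n} → Prime p → ¬ p ∣ n → Coprime p n
prime∤⇒coprime p-prime p∤n (d∣p , d∣n) with prime⇒irreducible p-prime d∣p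
... | inj₁ d≡1 = d≡1
... | inj₂ refl = contradiction d∣n p∤n

coprime⇒*∣ : ∀ {m n o} → Coprime m n → m ∣ o → n ∣ o → m * n ∣ o
coprime⇒*∣ {m} {n} coprime m∣o (divides q refl) with coprime-divisor coprime (subst (m ∣_) (*-comm q n) m∣o)
... | divides r refl = divides r (*-assoc r m n)

squareFree-prime* : ∀ {p s} → Prime p → SquareFree (p * s) ⇔ (SquareFree s × ¬ p ∣ s)
squareFree-prime* {p} {s} p-prime = mk⇔ to from
  where
  instance _ = prime⇒nonZero p-prime
  to : SquareFree (p * s) → SquareFree s × ¬ p ∣ s
  to (0<ps , noSquare) =
    (*-cancelˡ-< p 0 s (subst (_< p * s) (sym (*-zeroʳ p)) 0<ps) ,
     λ q q-prime q²∣s → noSquare q q-prime (∣-trans q²∣s (n∣m*n p))) ,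
    λ p∣s → noSquare p p-prime (*-monoʳ-∣ p p∣s)
  from : SquareFree s × ¬ p ∣ s → SquareFree (p * s)
  from ((0<s , noSquare) , p∤s) = ≤-trans 0<s (m≤n*m s p) , noSquareFactor
    where
    noSquareFactor : ∀ q → Prime q → ¬ q * q ∣ p * s
    noSquareFactor q q-prime q²∣ps with q ≟ p
    ... | yes refl = p∤s (*-cancelˡ-∣ q q²∣ps)
    ... | no  q≢p  =
      noSquare q q-prime (coprime-divisor (Coprime-sym (prime∤⇒coprime p-prime p∤q²)) q²∣ps)
      where
      p∤q² : ¬ p ∣ q * q
      p∤q² = q≢p ∘ sym ∘ prime∣prime⇒≡ p-prime q-prime ∘ reduce ∘ euclidsLemma q q p-prime

SquareFreeDivisor : ℕ → ℕ → Set
SquareFreeDivisor t d = SquareFree d × d ∣ t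

squareFreeDivisor? : ∀ t → Decidable (SquareFreeDivisor t)
squareFreeDivisor? t d = squareFree? d ×-dec d ∣? t

prime*-squareFreeDivisor : ∀ {p t s} → Prime p → p ∣ t →
  (SquareFreeDivisor t (p * s) × p ∣ p * s) ⇔ (SquareFreeDivisor t s × ¬ p ∣ s)
prime*-squareFreeDivisor {p} {t} {s} p-prime p∣t = mk⇔
  (λ ((sf , ps∣t) , _) → let sf′ , p∤s = Equivalence.to (squareFree-prime* p-prime) sf
                         in (sf′ , ∣-trans (n∣m*n p) ps∣t) , p∤s)
  (λ ((sf , s∣t) , p∤s) → (Equivalence.from (squareFree-prime* p-prime) (sf , p∤s) ,
                           coprime⇒*∣ (prime∤⇒coprime p-prime p∤s) p∣t s∣t) , m∣m*n s)

-- s ↦ p s matches the squarefree divisors of t prime to p with those divisible by p.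
squareFreeDivisors-pairing : ∀ {p t} .{{_ : NonZero t}} → Prime p → p ∣ t →
  parityUpTo (λ d → does (squareFreeDivisor? t d ×-dec p ∣? d)) t ≡
  parityUpTo (λ d → does (squareFreeDivisor? t d ×-dec ¬? (p ∣? d))) t
squareFreeDivisors-pairing {p} {t} p-prime p∣t@(divides t′ refl) = begin
  parityUpTo divisibleBy (t′ * p)     ≡⟨ cong (parityUpTo divisibleBy) (*-comm t′ p) ⟩
  parityUpTo divisibleBy (p * t′)     ≡⟨ parityUpTo-multiples divisibleBy p off-multiples t′ ⟩
  parityUpTo (divisibleBy ∘ (p *_)) t′ ≡⟨ parityUpTo-cong t′ (λ s _ _ → pair s) ⟩
  parityUpTo primeTo t′               ≡⟨ sym (parityUpTo-tail primeTo (m≤m*n t′ p) beyond) ⟩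
  parityUpTo primeTo (t′ * p)         ∎
  where
  open ≡-Reasoning
  instance _ = prime⇒nonZero p-prime
  divisibleBy primeTo : ℕ → Bool
  divisibleBy d = does (squareFreeDivisor? (t′ * p) d ×-dec p ∣? d)
  primeTo     d = does (squareFreeDivisor? (t′ * p) d ×-dec ¬? (p ∣? d))
  off-multiples : ∀ d → ¬ p ∣ d → divisibleBy d ≡ false
  off-multiples d p∤d = dec-false (squareFreeDivisor? (t′ * p) d ×-dec p ∣? d) (p∤d ∘ proj₂)
  pair : ∀ s → divisibleBy (p * s) ≡ primeTo s
  pair s = does-⇔ (prime*-squareFreeDivisor p-prime p∣t)
    (squareFreeDivisor? (t′ * p) (p * s) ×-dec p ∣? p * s) (squareFreeDivisor? (t′ * p) s ×-dec ¬? (p ∣? s))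
  beyond : ∀ d → t′ < d → d ≤ t′ * p → primeTo d ≡ false
  beyond d t′<d _ = dec-false (squareFreeDivisor? (t′ * p) d ×-dec ¬? (p ∣? d)) λ d-primeTo →
    let pd∣t = proj₂ (proj₁ (Equivalence.from (prime*-squareFreeDivisor p-prime p∣t) d-primeTo))
    in <⇒≱ t′<d (*-cancelˡ-≤ p (subst (p * d ≤_) (*-comm t′ p) (∣⇒≤ pd∣t)))

squareFreeDivisorParity : ∀ t → 0 < t → divisorParity (does ∘ squareFree?) t ≡ does (t ≟ 1)
squareFreeDivisorParity (suc zero)      _ =
  cong (_∧ does (1 ∣? 1)) (dec-true (squareFree? 1) squareFree[1])
squareFreeDivisorParity t@(suc (suc _)) _ with p , p-prime , p∣t ← ∃prime∣ t (s≤s z<s) = begin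
  parityUpTo (does ∘ squareFreeDivisor? t) t          ≡⟨ parityUpTo-split _ (does ∘ (p ∣?_)) t ⟩
  parityUpTo divisibleBy t xor parityUpTo primeTo t  ≡⟨ cong (_xor parityUpTo primeTo t) (squareFreeDivisors-pairing p-prime p∣t) ⟩
  parityUpTo primeTo t xor parityUpTo primeTo t      ≡⟨ xor-same (parityUpTo primeTo t) ⟩
  false                                              ≡⟨ sym (dec-false (t ≟ 1) λ ()) ⟩
  does (t ≟ 1)                                       ∎
  where
  open ≡-Reasoning
  divisibleBy primeTo : ℕ → Bool
  divisibleBy d = does (squareFreeDivisor? t d ×-dec p ∣? d)
  primeTo     d = does (squareFreeDivisor? t d ×-dec ¬? (p ∣? d))

InKSigma1⇒∣ : ∀ {k m} → InKSigma1 k m → k ∣ m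
InKSigma1⇒∣ {k} (s , _ , refl) = divides s (*-comm k s)

InKSigma1-* : ∀ k .{{_ : NonZero k}} s → InKSigma1 k (k * s) ⇔ SquareFree s
InKSigma1-* k s = mk⇔ (λ (s′ , sf , ks≡ks′) → subst SquareFree (sym (*-cancelˡ-≡ s s′ k ks≡ks′)) sf)
                      (λ sf → s , sf , refl)

inKSigma1? : ∀ k .{{_ : NonZero k}} → Decidable (InKSigma1 k)
inKSigma1? k m with k ∣? m
... | no  k∤m             = no (k∤m ∘ InKSigma1⇒∣)
... | yes (divides q refl) =
  map′ (subst (InKSigma1 k) (*-comm k q) ∘ Equivalence.from (InKSigma1-* k q))
       (Equivalence.to (InKSigma1-* k q) ∘ subst (InKSigma1 k) (*-comm q k))
       (squareFree? q)

inKSigma1-divisorParity : ∀ k .{{_ : NonZero k}} m → 0 < m → divisorParity (does ∘ inKSigma1? k) m ≡ does (m ≟ k)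
inKSigma1-divisorParity k m _ with k ∣? m
... | no k∤m = trans
  (parityUpTo-tail _ {N = m} z≤n λ d _ _ →
     dec-false (inKSigma1? k d ×-dec d ∣? m) λ (d∈kσ , d∣m) → k∤m (∣-trans (InKSigma1⇒∣ d∈kσ) d∣m))
  (sym (dec-false (m ≟ k) λ { refl → k∤m ∣-refl }))
inKSigma1-divisorParity k _ 0<tk | yes (divides t refl) = begin
  parityUpTo P (t * k)                                  ≡⟨ cong (parityUpTo P) (*-comm t k) ⟩
  parityUpTo P (k * t)                                  ≡⟨ parityUpTo-multiples P k off-multiples t ⟩
  parityUpTo (P ∘ (k *_)) t                             ≡⟨ parityUpTo-cong t (λ s _ _ → cong₂ _∧_ (multiple s) (divisor s)) ⟩
  divisorParity (does ∘ squareFree?) t                  ≡⟨ squareFreeDivisorParity t 0<t ⟩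
  does (t ≟ 1)                                          ≡⟨ does-⇔ t≡1⇔ (t ≟ 1) (t * k ≟ k) ⟩
  does (t * k ≟ k)                                      ∎
  where
  open ≡-Reasoning
  P : ℕ → Bool
  P d = does (inKSigma1? k d) ∧ does (d ∣? t * k)
  off-multiples : ∀ d → ¬ k ∣ d → P d ≡ false
  off-multiples d k∤d = dec-false (inKSigma1? k d ×-dec d ∣? t * k) (k∤d ∘ InKSigma1⇒∣ ∘ proj₁)
  multiple : ∀ s → does (inKSigma1? k (k * s)) ≡ does (squareFree? s)
  multiple s = does-⇔ (InKSigma1-* k s) (inKSigma1? k (k * s)) (squareFree? s)
  divisor : ∀ s → does (k * s ∣? t * k) ≡ does (s ∣? t)
  divisor s = does-⇔ (mk⇔ (*-cancelˡ-∣ k ∘ subst (k * s ∣_) (*-comm t k))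
                          (subst (k * s ∣_) (*-comm k t) ∘ *-monoʳ-∣ k))
                     (k * s ∣? t * k) (s ∣? t)
  0<t : 0 < t
  0<t = *-cancelʳ-< k 0 t 0<tk
  t≡1⇔ : t ≡ 1 ⇔ t * k ≡ k
  t≡1⇔ = mk⇔ (λ { refl → *-identityˡ k }) (λ tk≡k → *-cancelʳ-≡ t 1 k (trans tk≡k (sym (*-identityˡ k))))

-- u as a predicate on ℕ, false outside [1, n].
extend : ∀ {n} → (Fin n → Bool) → ℕ → Bool
extend {zero}  u _             = false
extend {suc n} u zero          = false
extend {suc n} u (suc zero)    = u Fin.zero
extend {suc n} u (suc (suc d)) = extend (u ∘ Fin.suc) (suc d)

extend-num : ∀ {n} (u : Fin n → Bool) i → extend u (num i) ≡ u i
extend-num u Fin.zero    = refl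
extend-num u (Fin.suc i) = extend-num (u ∘ Fin.suc) i

num-surjective : ∀ {n} m → 0 < m → m ≤ n → Σ (Fin n) λ j → num j ≡ m
num-surjective (suc m) _ m<n = fromℕ< m<n , cong suc (toℕ-fromℕ< m<n)

f≡divisorParity : ∀ {n} (u : Subset n) j → f u j ≡ divisorParity (extend u) (num j)
f≡divisorParity {n} u j = begin
  f u j                             ≡⟨ parity-cong n (λ i → cong₂ _∧_ (sym (extend-num u i)) (isYes≗does (num i ∣? num j))) ⟩
  parity n (P ∘ num)                ≡⟨ parity≡parityUpTo n P ⟩
  parityUpTo P n                    ≡⟨ divisorParity-upTo (extend u) z<s (toℕ<n j) ⟩
  divisorParity (extend u) (num j)  ∎
  where
  open ≡-Reasoning
  P : ℕ → Bool
  P d = extend u d ∧ does (d ∣? num j)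

f-preimage : ∀ {n} (u : Subset n) (P e : ℕ → Bool) → (∀ m → 0 < m → divisorParity P m ≡ e m) →
  (∀ i → u i ≡ P (num i)) ⇔ (∀ j → f u j ≡ e (num j))
f-preimage {n} u P e P-solves = mk⇔ to from
  where
  to : (∀ i → u i ≡ P (num i)) → ∀ j → f u j ≡ e (num j)
  to u≗P j = begin
    f u j                             ≡⟨ f≡divisorParity u j ⟩
    divisorParity (extend u) (num j)  ≡⟨ divisorParity-cong (num j) (λ d 0<d d≤j → extend≗P d 0<d (≤-trans d≤j (toℕ<n j))) ⟩
    divisorParity P (num j)           ≡⟨ P-solves (num j) z<s ⟩
    e (num j)                         ∎
    where
    open ≡-Reasoning
    extend≗P : ∀ d → 0 < d → d ≤ n → extend u d ≡ P d
    extend≗P d 0<d d≤n with j , refl ← num-surjective d 0<d d≤n = trans (extend-num u j) (u≗P j)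
  from : (∀ j → f u j ≡ e (num j)) → ∀ i → u i ≡ P (num i)
  from f≗e i = trans (sym (extend-num u i)) (divisorParity-injective n same-parity (num i) z<s (toℕ<n i))
    where
    same-parity : ∀ m → 0 < m → m ≤ n → divisorParity (extend u) m ≡ divisorParity P m
    same-parity m 0<m m≤n with j , refl ← num-surjective m 0<m m≤n =
      trans (sym (f≡divisorParity u j)) (trans (f≗e j) (sym (P-solves (num j) z<s)))

theorem10 : (n : ℕ) → 1 ≤ n → (k : ℕ) → 1 ≤ k → k ≤ n → (u : Subset n) →
    ((∀ (i : Fin n) → (u i ≡ true ⇔ InKSigma1 k (num i)))
      ⇔ (∀ (j : Fin n) → (num j ≡ k → f u j ≡ true) × (num j ≢ k → f u j ≡ false)))
theorem10 n _ k@(suc _) _ _ u =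
  ∀-⇔ (λ i → ≡true⇔⇔≡does (inKSigma1? k (num i)))
  ⟨ ⇔-trans ⟩ f-preimage u (does ∘ inKSigma1? k) (λ m → does (m ≟ k)) (inKSigma1-divisorParity k)
  ⟨ ⇔-trans ⟩ ⇔-sym (∀-⇔ λ j → cases⇔≡does (num j ≟ k))
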